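{- For $n\ge0$ let $A_n\in\mathbb N[t]$ be the polynomial $A_n=\sum_f t^{\#\{k:\ \#f^{ -1}(k)=1\}}$, where the sum runs over all maps $f:\{1,\dots,n\}\to\{1,\dots,n\}$ with $f(k)\le k$ for all $k$ and such that every element of $\{1,\dots,n\}$ has at most two preimages under $f$ (so $A_0=1$). Then $A_0=1,A_1=t,A_2=1+t^2,A_3=4t+t^3,\dots$ and for all $n\ge0$ $$A_{n+1}=\Big(1-\frac{t^2}{2}\Big)A_n'+t\,\frac{n+2}{2}A_n,$$ where $A_n'=dA_n/dt$.
   Context: These are the André polynomials; equivalently $\sum_n A_n\frac{s^n}{n!}=\sum_n([X^0]G_n)\frac{s^n}{n!}$ for $W=1+tX+\frac{X^2}{2}$, $G_0=1$, $G_{n+1}=(WG_n)'$. -}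

module Defs where

open import Data.Nat as ℕ using (ℕ; zero; suc; _≤?_; _≟_)
open import Data.Fin as Fin using (Fin; toℕ)
open import Data.Fin.Properties using (all?)
open import Data.List using (List; []; _∷_; length; filter; concatMap; map)
open import Data.Fin.Properties using () renaming (_≟_ to _≟F_)
open import Data.Vec.Functional using (Vector) renaming (_∷_ to _∷ᶠ_)
open import Data.List using () renaming (allFin to allFinL)
open import Data.Product using (_×_)
open import Relation.Nullary using (Dec; yes; no; _×-dec_)
open import Data.Integer using (+_)
open import Relation.Binary.PropositionalEquality using (_≡_)
open import Data.Rational as ℚ using (ℚ; 0ℚ; ½; _+_; _-_; _*_)

-- Polynomials in t with rational coefficients, represented by their
-- coefficient functions:  p represents  Σ_k p k · t^k.
-- (All polynomials below have finite support.)

ℕtoℚ : ℕ → ℚ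
ℕtoℚ m = (+ m) ℚ./ 1

Poly : Set
Poly = ℕ → ℚ

const : ℚ → Poly
const c zero    = c
const c (suc _) = 0ℚ

tPow : ℕ → Poly
tPow m k with m ≟ k
... | yes _ = ℚ.1ℚ
... | no  _ = 0ℚ

_⊕_ : Poly → Poly → Poly
(p ⊕ q) k = p k + q k

_⊖_ : Poly → Poly → Poly
(p ⊖ q) k = p k - q k

_⊛_ : ℚ → Poly → Poly
(c ⊛ p) k = c * p k

mulT : Poly → Poly
mulT p zero    = 0ℚ
mulT p (suc k) = p k

deriv : Poly → Poly
deriv p k = ℕtoℚ (suc k) * p (suc k)

-- All maps {1..m} → {1..n}, realised as Fin m → Fin n (0-indexed).

allFuns : (m n : ℕ) → List (Fin m → Fin n)
allFuns zero    n = (λ ()) ∷ []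
allFuns (suc m) n =
  concatMap (λ f → map (λ i → i ∷ᶠ f) (allFinL n)) (allFuns m n)

preimCount : ∀ {n} → (Fin n → Fin n) → Fin n → ℕ
preimCount {n} f k = length (filter (λ i → f i ≟F k) (allFinL n))

Valid : ∀ {n} → (Fin n → Fin n) → Set
Valid {n} f = (∀ k → toℕ (f k) ℕ.≤ toℕ k) × (∀ k → preimCount f k ℕ.≤ 2)

valid? : ∀ {n} (f : Fin n → Fin n) → Dec (Valid f)
valid? f = all? (λ k → toℕ (f k) ≤? toℕ k) ×-dec all? (λ k → preimCount f k ≤? 2)

singletons : ∀ {n} → (Fin n → Fin n) → ℕ
singletons {n} f = length (filter (λ k → preimCount f k ≟ 1) (allFinL n))

A : ℕ → Poly
A n j = ℕtoℚ (length (filter (λ f → valid? f ×-dec (singletons f ≟ j)) (allFuns n n)))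

module Submission where

-- Build a map f by choosing f 0, f 1, … in turn.  Once the points 0, …, o − 1 are mapped, only two
-- numbers of the fibre profile matter: z, the number of empty fibres among 0, …, o − 1, and s, the
-- number of singleton fibres.  The point o may go to one of the z + 1 empty fibres among 0, …, o,
-- leading to (z, s + 1), or to one of the s singletons, leading to (z + 1, s − 1); fibres of size
-- two are full.  So the coefficient of t^j in A n counts the n-step walks from (0, 0) ending at
-- s = j, with these multiplicities.  Splitting off the last step of a walk rather than the first,
-- A (n + 1) is obtained from A n by t^s ↦ (z + 1) t^(s + 1) + s t^(s − 1); since every step raises
-- 2z + s by one, z = (n − s)/2 after n steps, which turns this map into the stated differential
-- operator.

open import Defs
open import Data.Bool using (true; false; if_then_else_)
open import Data.Fin using (Fin; toℕ)
open import Data.Fin.Properties using (all?) renaming (_≟_ to _≟ᶠ_)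
import Data.Integer as ℤ
import Data.Integer.Properties as ℤ
open import Data.List using (List; []; _∷_; _++_; map; concatMap; filter; tabulate; length; allFin)
open import Data.List.Properties using (map-++; map-cong; map-tabulate)
import Data.Nat.Coprimality as Coprime
open import Data.Nat using (ℕ; zero; suc; _+_; _*_; _∸_; _≤_; _<_; _≤?_; _<?_; _≟_; z≤n; s≤s)
open import Data.Nat.ListAction using () renaming (sum to sumᴸ)
open import Data.Nat.ListAction.Properties using () renaming (sum-++ to sumᴸ-++)
open import Data.Nat.Properties
  using ( +-*-semiring; +-commutativeSemigroup; +-assoc; +-comm; +-identityʳ; +-suc; suc-injective
        ; m+n∸n≡m; m≤n+m; m<m+n; ≤-trans; ≤-reflexive; ≤⇒≯; <⇒≱; <⇒≤; ≰⇒>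
        ; *-identityˡ; *-zeroʳ; *-assoc; *-distribˡ-+; *-distribʳ-+ )
open import Data.Nat.Tactic.RingSolver using (solve-∀)
open import Data.Product using (_×_; _,_; uncurry)
open import Data.Rational as ℚ using (ℚ; mkℚ; ½; 1ℚ)
import Data.Rational.Properties as ℚ
open import Data.Rational.Solver using (module +-*-Solver)
open import Data.Vec.Functional using () renaming (_∷_ to _∷ᶠ_)
open import Function using (_∘_)
open import Relation.Binary.PropositionalEquality
open import Relation.Nullary using (Dec; yes; no; does; ¬_; _×-dec_; contradiction)

open import Algebra.Properties.Semiring.Sum +-*-semiring
  using (sum-syntax; sum-cong-≗; sum-replicate-zero; ∑-distrib-+; *-distribʳ-sum)
open import Algebra.Properties.CommutativeSemigroup +-commutativeSemigroup using (xy∙z≈zy∙x; x∙yz≈yx∙z)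

𝟙 : ∀ {p} {P : Set p} → Dec P → ℕ
𝟙 d = if does d then 1 else 0

module _ {p} {P : Set p} where

  𝟙-yes : P → (d : Dec P) → 𝟙 d ≡ 1
  𝟙-yes _ (yes _) = refl
  𝟙-yes p (no ¬p) = contradiction p ¬p

  𝟙-no : ¬ P → (d : Dec P) → 𝟙 d ≡ 0
  𝟙-no ¬p (yes p) = contradiction p ¬p
  𝟙-no _  (no _)  = refl

module _ {p q} {P : Set p} {Q : Set q} where

  𝟙-⇔ : (P → Q) → (Q → P) → (d : Dec P) (e : Dec Q) → 𝟙 d ≡ 𝟙 e
  𝟙-⇔ to from (yes p) e = sym (𝟙-yes (to p) e)
  𝟙-⇔ to from (no ¬p) e = sym (𝟙-no (¬p ∘ from) e)

  𝟙-×-dec : (d : Dec P) (e : Dec Q) → 𝟙 (d ×-dec e) ≡ 𝟙 d * 𝟙 e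
  𝟙-×-dec (yes _) (yes _) = refl
  𝟙-×-dec (yes _) (no _)  = refl
  𝟙-×-dec (no _)  _       = refl

  𝟙-*-implied : (d : Dec P) (e : Dec Q) → (P → Q) → 𝟙 d * 𝟙 e ≡ 𝟙 d
  𝟙-*-implied (yes p) e P⇒Q = trans (+-identityʳ (𝟙 e)) (𝟙-yes (P⇒Q p) e)
  𝟙-*-implied (no _)  e _   = refl

𝟙-<-suc : ∀ m n → 𝟙 (m <? suc n) ≡ 𝟙 (m ≤? n)
𝟙-<-suc zero    n = refl
𝟙-<-suc (suc m) n = refl

𝟙-≤-split : ∀ m n → 𝟙 (m ≤? n) ≡ 𝟙 (m <? n) + 𝟙 (m ≟ n)
𝟙-≤-split zero    zero    = refl
𝟙-≤-split zero    (suc n) = refl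
𝟙-≤-split (suc m) zero    = refl
𝟙-≤-split (suc m) (suc n) = trans (𝟙-<-suc m n) (𝟙-≤-split m n)

*-𝟙-≡ : ∀ m n (m≟n : Dec (m ≡ n)) → m * 𝟙 m≟n ≡ n * 𝟙 m≟n
*-𝟙-≡ m n (yes refl) = refl
*-𝟙-≡ m n (no _)     = trans (*-zeroʳ m) (sym (*-zeroʳ n))

𝟙-all?-suc : ∀ {m p} {P : Fin (suc m) → Set p} (P? : ∀ k → Dec (P k)) →
  𝟙 (all? P?) ≡ 𝟙 (P? Fin.zero) * 𝟙 (all? (P? ∘ Fin.suc))
𝟙-all?-suc {P = P} P? =
  trans (𝟙-⇔ (λ ∀P → ∀P Fin.zero , ∀P ∘ Fin.suc) from (all? P?) (P? Fin.zero ×-dec all? (P? ∘ Fin.suc)))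
        (𝟙-×-dec (P? Fin.zero) (all? (P? ∘ Fin.suc)))
  where
    from : P Fin.zero × (∀ k → P (Fin.suc k)) → ∀ k → P k
    from (P₀ , _)  Fin.zero    = P₀
    from (_  , Pₛ) (Fin.suc k) = Pₛ k

𝟙-all?-≤-cong : ∀ {n} {a a′ b b′ : Fin n → ℕ} → (∀ k → a k ≡ a′ k) → (∀ k → b k ≡ b′ k) →
  𝟙 (all? λ k → a k ≤? b k) ≡ 𝟙 (all? λ k → a′ k ≤? b′ k)
𝟙-all?-≤-cong {a = a} {a′} {b} {b′} a≗a′ b≗b′ =
  𝟙-⇔ (λ a≤b k → subst₂ _≤_ (a≗a′ k) (b≗b′ k) (a≤b k))
      (λ a′≤b′ k → subst₂ _≤_ (sym (a≗a′ k)) (sym (b≗b′ k)) (a′≤b′ k))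
      (all? λ k → a k ≤? b k) (all? λ k → a′ k ≤? b′ k)

∑-zero : ∀ {n} {f : Fin n → ℕ} → (∀ i → f i ≡ 0) → ∑[ i < n ] f i ≡ 0
∑-zero {n} f≗0 = trans (sum-cong-≗ f≗0) (sum-replicate-zero n)

∑-𝟙-toℕ≡ : ∀ {n o} → o < n → ∑[ y < n ] 𝟙 (toℕ y ≟ o) ≡ 1
∑-𝟙-toℕ≡ {suc n} {zero}  _         = cong suc (sum-replicate-zero n)
∑-𝟙-toℕ≡ {suc n} {suc o} (s≤s o<n) = ∑-𝟙-toℕ≡ o<n

increment : ∀ {N} → (Fin N → ℕ) → Fin N → Fin N → ℕ
increment c i y = 𝟙 (i ≟ᶠ y) + c y

∑-increment : ∀ {N} (F : Fin N → ℕ → ℕ) (c : Fin N → ℕ) (i : Fin N) →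
  ∑[ y < N ] F y (increment c i y) + F i (c i) ≡ ∑[ y < N ] F y (c y) + F i (suc (c i))
∑-increment {suc N} F c Fin.zero    = xy∙z≈zy∙x (F Fin.zero (suc (c Fin.zero))) _ _
∑-increment {suc N} F c (Fin.suc i) = begin
  (F₀ + ∑[ y < N ] F (Fin.suc y) (increment c (Fin.suc i) (Fin.suc y))) + F (Fin.suc i) (c (Fin.suc i))
    ≡⟨ +-assoc F₀ _ _ ⟩
  F₀ + (∑[ y < N ] F (Fin.suc y) (increment (c ∘ Fin.suc) i y) + F (Fin.suc i) (c (Fin.suc i)))
    ≡⟨ cong (F₀ +_) (∑-increment (F ∘ Fin.suc) (c ∘ Fin.suc) i) ⟩
  F₀ + (∑[ y < N ] F (Fin.suc y) (c (Fin.suc y)) + F (Fin.suc i) (suc (c (Fin.suc i))))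
    ≡⟨ +-assoc F₀ _ _ ⟨
  (F₀ + ∑[ y < N ] F (Fin.suc y) (c (Fin.suc y))) + F (Fin.suc i) (suc (c (Fin.suc i))) ∎
  where
    open ≡-Reasoning
    F₀ : ℕ
    F₀ = F Fin.zero (c Fin.zero)

length-filter≡sum : ∀ {a p} {A : Set a} {P : A → Set p} (P? : ∀ x → Dec (P x)) (xs : List A) →
  length (filter P? xs) ≡ sumᴸ (map (𝟙 ∘ P?) xs)
length-filter≡sum P? [] = refl
length-filter≡sum P? (x ∷ xs) with does (P? x)
... | true  = cong suc (length-filter≡sum P? xs)
... | false = length-filter≡sum P? xs

sumᴸ-tabulate : ∀ {n} (f : Fin n → ℕ) → sumᴸ (tabulate f) ≡ ∑[ i < n ] f i
sumᴸ-tabulate {zero}  f = refl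
sumᴸ-tabulate {suc n} f = cong (f Fin.zero +_) (sumᴸ-tabulate (f ∘ Fin.suc))

length-filter-allFin : ∀ {n p} {P : Fin n → Set p} (P? : ∀ i → Dec (P i)) →
  length (filter P? (allFin n)) ≡ ∑[ i < n ] 𝟙 (P? i)
length-filter-allFin {n} P? = begin
  length (filter P? (allFin n))    ≡⟨ length-filter≡sum P? (allFin n) ⟩
  sumᴸ (map (𝟙 ∘ P?) (allFin n))  ≡⟨ cong sumᴸ (map-tabulate (λ i → i) (𝟙 ∘ P?)) ⟩
  sumᴸ (tabulate (𝟙 ∘ P?))        ≡⟨ sumᴸ-tabulate (𝟙 ∘ P?) ⟩
  ∑[ i < n ] 𝟙 (P? i)             ∎
  where open ≡-Reasoning

module _ {a b} {A : Set a} {B : Set b} where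

  sumᴸ-map-concatMap : (F : B → ℕ) (g : A → List B) (xs : List A) →
    sumᴸ (map F (concatMap g xs)) ≡ sumᴸ (map (λ x → sumᴸ (map F (g x))) xs)
  sumᴸ-map-concatMap F g []       = refl
  sumᴸ-map-concatMap F g (x ∷ xs) = begin
    sumᴸ (map F (g x ++ concatMap g xs))               ≡⟨ cong sumᴸ (map-++ F (g x) _) ⟩
    sumᴸ (map F (g x) ++ map F (concatMap g xs))       ≡⟨ sumᴸ-++ (map F (g x)) _ ⟩
    sumᴸ (map F (g x)) + sumᴸ (map F (concatMap g xs)) ≡⟨ cong (_ +_) (sumᴸ-map-concatMap F g xs) ⟩
    sumᴸ (map F (g x)) + sumᴸ (map (λ x → sumᴸ (map F (g x))) xs) ∎
    where open ≡-Reasoning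

module _ {a} {A : Set a} where

  sumᴸ-map-*ˡ : ∀ k (F : A → ℕ) (xs : List A) → sumᴸ (map (λ x → k * F x) xs) ≡ k * sumᴸ (map F xs)
  sumᴸ-map-*ˡ k F []       = sym (*-zeroʳ k)
  sumᴸ-map-*ˡ k F (x ∷ xs) = trans (cong (k * F x +_) (sumᴸ-map-*ˡ k F xs)) (sym (*-distribˡ-+ k (F x) _))

  sumᴸ-map-∑ : ∀ {n} (G : Fin n → A → ℕ) (xs : List A) →
    sumᴸ (map (λ x → ∑[ i < n ] G i x) xs) ≡ ∑[ i < n ] sumᴸ (map (G i) xs)
  sumᴸ-map-∑ {n} G []       = sym (sum-replicate-zero n)
  sumᴸ-map-∑ {n} G (x ∷ xs) =
    trans (cong (∑[ i < n ] G i x +_) (sumᴸ-map-∑ G xs)) (sym (∑-distrib-+ (λ i → G i x) _))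

sumᴸ-allFuns-zero : ∀ N {F : (Fin 0 → Fin N) → ℕ} {v} → (∀ e → F e ≡ v) → sumᴸ (map F (allFuns 0 N)) ≡ v
sumᴸ-allFuns-zero N F≡v = trans (+-identityʳ _) (F≡v _)

sumᴸ-allFuns-suc : ∀ m N (F : (Fin (suc m) → Fin N) → ℕ) →
  sumᴸ (map F (allFuns (suc m) N)) ≡ sumᴸ (map (λ f → ∑[ i < N ] F (i ∷ᶠ f)) (allFuns m N))
sumᴸ-allFuns-suc m N F = trans (sumᴸ-map-concatMap F _ (allFuns m N)) (cong sumᴸ (map-cong sum-row (allFuns m N)))
  where
    sum-row : ∀ f → sumᴸ (map F (map (_∷ᶠ f) (allFin N))) ≡ ∑[ i < N ] F (i ∷ᶠ f)
    sum-row f = begin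
      sumᴸ (map F (map (_∷ᶠ f) (allFin N))) ≡⟨ cong (sumᴸ ∘ map F) (map-tabulate (λ i → i) (_∷ᶠ f)) ⟩
      sumᴸ (map F (tabulate (_∷ᶠ f)))      ≡⟨ cong sumᴸ (map-tabulate (_∷ᶠ f) F) ⟩
      sumᴸ (tabulate (F ∘ (_∷ᶠ f)))        ≡⟨ sumᴸ-tabulate (F ∘ (_∷ᶠ f)) ⟩
      ∑[ i < N ] F (i ∷ᶠ f)                 ∎
      where open ≡-Reasoning

-- Fibre profiles

fibre : ∀ {m N} → (Fin m → Fin N) → Fin N → ℕ
fibre {m} f y = ∑[ k < m ] 𝟙 (f k ≟ᶠ y)

singletonCount : ∀ {N} → (Fin N → ℕ) → ℕ
singletonCount {N} c = ∑[ y < N ] 𝟙 (c y ≟ 1)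

zeroCountBelow : ∀ {N} → ℕ → (Fin N → ℕ) → ℕ
zeroCountBelow {N} o c = ∑[ y < N ] (𝟙 (toℕ y <? o) * 𝟙 (c y ≟ 0))

record Admissible {N} (o : ℕ) (c : Fin N → ℕ) : Set where
  field
    vanishing : ∀ y → o ≤ toℕ y → c y ≡ 0
    atMostTwo : ∀ y → c y ≤ 2

module _ {N o} {c : Fin N → ℕ} (adm : Admissible o c) where
  open Admissible adm

  admissible-increment : ∀ {i} → toℕ i ≤ o → c i ≤ 1 → Admissible (suc o) (increment c i)
  admissible-increment {i} i≤o cᵢ≤1 = record
    { vanishing = λ y o<y → cong₂ _+_ (𝟙-no (λ i≡y → <⇒≱ o<y (subst (λ k → toℕ k ≤ o) i≡y i≤o)) (i ≟ᶠ y))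
                                      (vanishing y (<⇒≤ o<y))
    ; atMostTwo = λ y → bounded y (i ≟ᶠ y)
    }
    where
      bounded : ∀ y (i≟y : Dec (i ≡ y)) → 𝟙 i≟y + c y ≤ 2
      bounded y (yes refl) = s≤s cᵢ≤1
      bounded y (no _)     = atMostTwo y

  zeroCountBelow-suc : o < N → zeroCountBelow (suc o) c ≡ suc (zeroCountBelow o c)
  zeroCountBelow-suc o<N = begin
    ∑[ y < N ] (𝟙 (toℕ y <? suc o) * 𝟙 (c y ≟ 0))
      ≡⟨ sum-cong-≗ split ⟩
    ∑[ y < N ] (𝟙 (toℕ y <? o) * 𝟙 (c y ≟ 0) + 𝟙 (toℕ y ≟ o))
      ≡⟨ ∑-distrib-+ (λ y → 𝟙 (toℕ y <? o) * 𝟙 (c y ≟ 0)) (λ y → 𝟙 (toℕ y ≟ o)) ⟩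
    zeroCountBelow o c + ∑[ y < N ] 𝟙 (toℕ y ≟ o)
      ≡⟨ cong (zeroCountBelow o c +_) (∑-𝟙-toℕ≡ o<N) ⟩
    zeroCountBelow o c + 1
      ≡⟨ +-comm (zeroCountBelow o c) 1 ⟩
    suc (zeroCountBelow o c) ∎
    where
      open ≡-Reasoning
      split : ∀ y → 𝟙 (toℕ y <? suc o) * 𝟙 (c y ≟ 0) ≡ 𝟙 (toℕ y <? o) * 𝟙 (c y ≟ 0) + 𝟙 (toℕ y ≟ o)
      split y = begin
        𝟙 (toℕ y <? suc o) * 𝟙 (c y ≟ 0)
          ≡⟨ cong (_* 𝟙 (c y ≟ 0)) (trans (𝟙-<-suc (toℕ y) o) (𝟙-≤-split (toℕ y) o)) ⟩
        (𝟙 (toℕ y <? o) + 𝟙 (toℕ y ≟ o)) * 𝟙 (c y ≟ 0)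
          ≡⟨ *-distribʳ-+ (𝟙 (c y ≟ 0)) (𝟙 (toℕ y <? o)) _ ⟩
        𝟙 (toℕ y <? o) * 𝟙 (c y ≟ 0) + 𝟙 (toℕ y ≟ o) * 𝟙 (c y ≟ 0)
          ≡⟨ cong (𝟙 (toℕ y <? o) * 𝟙 (c y ≟ 0) +_)
                  (𝟙-*-implied (toℕ y ≟ o) (c y ≟ 0) (λ y≡o → vanishing y (≤-reflexive (sym y≡o)))) ⟩
        𝟙 (toℕ y <? o) * 𝟙 (c y ≟ 0) + 𝟙 (toℕ y ≟ o) ∎

  module _ {i : Fin N} (o<N : o < N) (i≤o : toℕ i ≤ o) where

    private
      Z Z′ S S′ : ℕ
      Z  = zeroCountBelow o c
      Z′ = zeroCountBelow (suc o) (increment c i)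
      S  = singletonCount c
      S′ = singletonCount (increment c i)

    zeroCountBelow-increment : Z′ + 𝟙 (c i ≟ 0) ≡ suc Z
    zeroCountBelow-increment = begin
      Z′ + 𝟙 (c i ≟ 0)
        ≡⟨ cong (Z′ +_) (trans (cong (_* 𝟙 (c i ≟ 0)) (𝟙-yes (s≤s i≤o) (toℕ i <? suc o))) (*-identityˡ _)) ⟨
      Z′ + F i (c i)
        ≡⟨ ∑-increment F c i ⟩
      zeroCountBelow (suc o) c + F i (suc (c i))
        ≡⟨ cong₂ _+_ (zeroCountBelow-suc o<N) (*-zeroʳ (𝟙 (toℕ i <? suc o))) ⟩
      suc Z + 0
        ≡⟨ +-identityʳ (suc Z) ⟩
      suc Z ∎
      where
        open ≡-Reasoning
        F : Fin N → ℕ → ℕ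
        F y v = 𝟙 (toℕ y <? suc o) * 𝟙 (v ≟ 0)

    singletonCount-increment : S′ + 𝟙 (c i ≟ 1) ≡ S + 𝟙 (suc (c i) ≟ 1)
    singletonCount-increment = ∑-increment (λ _ v → 𝟙 (v ≟ 1)) c i

    increment-empty : c i ≡ 0 → Z′ ≡ Z × S′ ≡ suc S
    increment-empty cᵢ≡0 =
        suc-injective (trans (+-comm 1 Z′) (subst (λ v → Z′ + 𝟙 (v ≟ 0) ≡ suc Z) cᵢ≡0 zeroCountBelow-increment))
      , trans (sym (+-identityʳ S′))
              (trans (subst (λ v → S′ + 𝟙 (v ≟ 1) ≡ S + 𝟙 (suc v ≟ 1)) cᵢ≡0 singletonCount-increment) (+-comm S 1))

    increment-singleton : c i ≡ 1 → Z′ ≡ suc Z × S′ ≡ S ∸ 1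
    increment-singleton cᵢ≡1 =
        trans (sym (+-identityʳ Z′)) (subst (λ v → Z′ + 𝟙 (v ≟ 0) ≡ suc Z) cᵢ≡1 zeroCountBelow-increment)
      , trans (sym (m+n∸n≡m S′ 1))
              (cong (_∸ 1) (trans (subst (λ v → S′ + 𝟙 (v ≟ 1) ≡ S + 𝟙 (suc v ≟ 1)) cᵢ≡1 singletonCount-increment)
                                  (+-identityʳ S)))

-- Weighted walks on the states (z, s)

step : (ℕ → ℕ → ℕ) → ℕ → ℕ → ℕ
step φ z s = suc z * φ z (suc s) + s * φ (suc z) (s ∸ 1)

walk : ℕ → (ℕ → ℕ → ℕ) → ℕ → ℕ → ℕ
walk zero    φ = φ
walk (suc m) φ = step (walk m φ)

δ : ℕ → ℕ → ℕ → ℕ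
δ j _ s = 𝟙 (s ≟ j)

step-cong : ∀ {φ ψ : ℕ → ℕ → ℕ} → (∀ z s → φ z s ≡ ψ z s) → ∀ z s → step φ z s ≡ step ψ z s
step-cong φ≗ψ z s = cong₂ (λ a b → suc z * a + s * b) (φ≗ψ z (suc s)) (φ≗ψ (suc z) (s ∸ 1))

step-+ : ∀ φ ψ z s → step (λ z s → φ z s + ψ z s) z s ≡ step φ z s + step ψ z s
step-+ φ ψ z s = regroup (suc z) s (φ z (suc s)) (ψ z (suc s)) (φ (suc z) (s ∸ 1)) (ψ (suc z) (s ∸ 1))
  where
    regroup : ∀ a b x y u v → a * (x + y) + b * (u + v) ≡ (a * x + b * u) + (a * y + b * v)
    regroup = solve-∀

step-*ˡ : ∀ k φ z s → step (λ z s → k * φ z s) z s ≡ k * step φ z s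
step-*ˡ k φ z s = regroup (suc z) s k (φ z (suc s)) (φ (suc z) (s ∸ 1))
  where
    regroup : ∀ a b k x u → a * (k * x) + b * (k * u) ≡ k * (a * x + b * u)
    regroup = solve-∀

-- Each step raises 2 z + s by exactly one.
step-invariant : ∀ m φ z s → step (λ z s → (m + (2 * z + s)) * φ z s) z s ≡ (suc m + (2 * z + s)) * step φ z s
step-invariant m φ z zero    = regroup m z (φ z 1)
  where
    regroup : ∀ m z a → suc z * ((m + (2 * z + 1)) * a) + 0 ≡ (suc m + (2 * z + 0)) * (suc z * a + 0)
    regroup = solve-∀
step-invariant m φ z (suc s) = regroup m z s (φ z (2 + s)) (φ (suc z) s)
  where
    regroup : ∀ m z s a b → suc z * ((m + (2 * z + (2 + s))) * a) + suc s * ((m + (2 * suc z + s)) * b)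
                          ≡ (suc m + (2 * z + suc s)) * (suc z * a + suc s * b)
    regroup = solve-∀

walk-cong : ∀ m {φ ψ : ℕ → ℕ → ℕ} → (∀ z s → φ z s ≡ ψ z s) → ∀ z s → walk m φ z s ≡ walk m ψ z s
walk-cong zero    φ≗ψ = φ≗ψ
walk-cong (suc m) φ≗ψ = step-cong (walk-cong m φ≗ψ)

walk-+ : ∀ m φ ψ z s → walk m (λ z s → φ z s + ψ z s) z s ≡ walk m φ z s + walk m ψ z s
walk-+ zero    φ ψ z s = refl
walk-+ (suc m) φ ψ z s = trans (step-cong (walk-+ m φ ψ) z s) (step-+ (walk m φ) (walk m ψ) z s)

walk-*ˡ : ∀ m k φ z s → walk m (λ z s → k * φ z s) z s ≡ k * walk m φ z s
walk-*ˡ zero    k φ z s = refl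
walk-*ˡ (suc m) k φ z s = trans (step-cong (walk-*ˡ m k φ) z s) (step-*ˡ k (walk m φ) z s)

walk-suc : ∀ m φ z s → walk (suc m) φ z s ≡ walk m (step φ) z s
walk-suc zero    φ z s = refl
walk-suc (suc m) φ z s = step-cong (walk-suc m φ) z s

walk-invariant : ∀ m φ z s → walk m (λ z s → (2 * z + s) * φ z s) z s ≡ (m + (2 * z + s)) * walk m φ z s
walk-invariant zero    φ z s = refl
walk-invariant (suc m) φ z s = trans (step-cong (walk-invariant m φ) z s) (step-invariant m (walk m φ) z s)

step-δ-zero : ∀ z s → step (δ 0) z s ≡ δ 1 z s
step-δ-zero z zero          = cong (_+ 0) (*-zeroʳ (suc z))
step-δ-zero z (suc zero)    = cong (_+ 1) (*-zeroʳ (suc z))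
step-δ-zero z (suc (suc s)) = cong₂ _+_ (*-zeroʳ (suc z)) (*-zeroʳ (2 + s))

step-δ-suc : ∀ k z s →
  2 * step (δ (suc k)) z s + k * δ k z s ≡ (2 * z + s) * δ k z s + 2 * δ k z s + 2 * (2 + k) * δ (2 + k) z s
step-δ-suc k z s = begin
  2 * (suc z * δ k z s + s * 𝟙 (s ∸ 1 ≟ suc k)) + k * δ k z s
    ≡⟨ cong₂ (λ a b → 2 * (suc z * δ k z s + a) + b) (from-predecessor s) (sym (*-𝟙-≡ s k (s ≟ k))) ⟩
  2 * (suc z * δ k z s + (2 + k) * δ (2 + k) z s) + s * δ k z s
    ≡⟨ regroup z s k (δ k z s) (δ (2 + k) z s) ⟩
  (2 * z + s) * δ k z s + 2 * δ k z s + 2 * (2 + k) * δ (2 + k) z s ∎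
  where
    open ≡-Reasoning
    from-predecessor : ∀ s → s * 𝟙 (s ∸ 1 ≟ suc k) ≡ (2 + k) * 𝟙 (s ≟ 2 + k)
    from-predecessor zero    = sym (*-zeroʳ (2 + k))
    from-predecessor (suc s) = *-𝟙-≡ (suc s) (2 + k) (suc s ≟ 2 + k)
    regroup : ∀ z s k a b → 2 * (suc z * a + (2 + k) * b) + s * a ≡ (2 * z + s) * a + 2 * a + 2 * (2 + k) * b
    regroup = solve-∀

walk-δ-zero : ∀ n → walk (suc n) (δ 0) 0 0 ≡ walk n (δ 1) 0 0
walk-δ-zero n = trans (walk-suc n (δ 0) 0 0) (walk-cong n step-δ-zero 0 0)

walk-δ-suc : ∀ n k →
  2 * walk (suc n) (δ (suc k)) 0 0 + k * walk n (δ k) 0 0 ≡ (n + 2) * walk n (δ k) 0 0 + 2 * (2 + k) * walk n (δ (2 + k)) 0 0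
walk-δ-suc n k = begin
  2 * walk (suc n) (δ (suc k)) 0 0 + k * W k
    ≡⟨ cong (λ w → 2 * w + k * W k) (walk-suc n (δ (suc k)) 0 0) ⟩
  2 * walk n (step (δ (suc k))) 0 0 + k * W k
    ≡⟨ cong₂ _+_ (walk-*ˡ n 2 (step (δ (suc k))) 0 0) (walk-*ˡ n k (δ k) 0 0) ⟨
  walk n (λ z s → 2 * step (δ (suc k)) z s) 0 0 + walk n (λ z s → k * δ k z s) 0 0
    ≡⟨ walk-+ n (λ z s → 2 * step (δ (suc k)) z s) (λ z s → k * δ k z s) 0 0 ⟨
  walk n (λ z s → 2 * step (δ (suc k)) z s + k * δ k z s) 0 0
    ≡⟨ walk-cong n (step-δ-suc k) 0 0 ⟩
  walk n (λ z s → (2 * z + s) * δ k z s + 2 * δ k z s + 2 * (2 + k) * δ (2 + k) z s) 0 0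
    ≡⟨ walk-+ n (λ z s → (2 * z + s) * δ k z s + 2 * δ k z s) (λ z s → 2 * (2 + k) * δ (2 + k) z s) 0 0 ⟩
  walk n (λ z s → (2 * z + s) * δ k z s + 2 * δ k z s) 0 0 + walk n (λ z s → 2 * (2 + k) * δ (2 + k) z s) 0 0
    ≡⟨ cong₂ _+_ (walk-+ n (λ z s → (2 * z + s) * δ k z s) (λ z s → 2 * δ k z s) 0 0)
                 (walk-*ˡ n (2 * (2 + k)) (δ (2 + k)) 0 0) ⟩
  (walk n (λ z s → (2 * z + s) * δ k z s) 0 0 + walk n (λ z s → 2 * δ k z s) 0 0) + 2 * (2 + k) * W (2 + k)
    ≡⟨ cong (_+ 2 * (2 + k) * W (2 + k)) (cong₂ _+_ (walk-invariant n (δ k) 0 0) (walk-*ˡ n 2 (δ k) 0 0)) ⟩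
  ((n + 0) * W k + 2 * W k) + 2 * (2 + k) * W (2 + k)
    ≡⟨ cong (_+ 2 * (2 + k) * W (2 + k)) (regroup n (W k)) ⟩
  (n + 2) * W k + 2 * (2 + k) * W (2 + k) ∎
  where
    open ≡-Reasoning
    W : ℕ → ℕ
    W j = walk n (δ j) 0 0
    regroup : ∀ n a → (n + 0) * a + 2 * a ≡ (n + 2) * a
    regroup = solve-∀

-- Completions of a partial map

module Completions (N j : ℕ) where
  open Admissible

  accepted : (Fin N → ℕ) → ℕ
  accepted c = 𝟙 (all? λ y → c y ≤? 2) * 𝟙 (singletonCount c ≟ j)

  -- Weight of continuing a map whose first o points produced the fibre sizes c by sending the
  -- point o + k to f k.
  weight : ∀ {m} → ℕ → (Fin N → ℕ) → (Fin m → Fin N) → ℕ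
  weight o c f = 𝟙 (all? λ k → toℕ (f k) ≤? o + toℕ k) * accepted (λ y → c y + fibre f y)

  completions : ℕ → ℕ → (Fin N → ℕ) → ℕ
  completions m o c = sumᴸ (map (weight o c) (allFuns m N))

  accepted-cong : ∀ {c c′ : Fin N → ℕ} → (∀ y → c y ≡ c′ y) → accepted c ≡ accepted c′
  accepted-cong c≗c′ =
    cong₂ _*_ (𝟙-all?-≤-cong c≗c′ (λ _ → refl))
              (cong (λ s → 𝟙 (s ≟ j)) (sum-cong-≗ (λ y → cong (λ v → 𝟙 (v ≟ 1)) (c≗c′ y))))

  weight-empty : ∀ o c (e : Fin 0 → Fin N) → weight o c e ≡ accepted c
  weight-empty o c e = trans (*-identityˡ _) (accepted-cong (λ y → +-identityʳ (c y)))

  weight-cons : ∀ {m} o c (i : Fin N) (f : Fin m → Fin N) →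
    weight o c (i ∷ᶠ f) ≡ 𝟙 (toℕ i ≤? o) * weight (suc o) (increment c i) f
  weight-cons o c i f = begin
    𝟙 (all? Q) * accepted (λ y → c y + fibre (i ∷ᶠ f) y)
      ≡⟨ cong₂ _*_ (𝟙-all?-suc Q) (accepted-cong (λ y → x∙yz≈yx∙z (c y) (𝟙 (i ≟ᶠ y)) (fibre f y))) ⟩
    (𝟙 (Q Fin.zero) * 𝟙 (all? (Q ∘ Fin.suc))) * accepted (λ y → increment c i y + fibre f y)
      ≡⟨ cong (_* accepted (λ y → increment c i y + fibre f y))
              (cong₂ _*_ (cong (λ b → 𝟙 (toℕ i ≤? b)) (+-identityʳ o))
                         (𝟙-all?-≤-cong {a = toℕ ∘ f} (λ _ → refl) (λ k → +-suc o (toℕ k)))) ⟩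
    (𝟙 (toℕ i ≤? o) * 𝟙 (all? λ k → toℕ (f k) ≤? suc o + toℕ k)) * accepted (λ y → increment c i y + fibre f y)
      ≡⟨ *-assoc (𝟙 (toℕ i ≤? o)) _ _ ⟩
    𝟙 (toℕ i ≤? o) * weight (suc o) (increment c i) f ∎
    where
      open ≡-Reasoning
      Q : ∀ k → Dec (toℕ ((i ∷ᶠ f) k) ≤ o + toℕ k)
      Q k = toℕ ((i ∷ᶠ f) k) ≤? o + toℕ k

  completions-zero : ∀ o c → completions 0 o c ≡ accepted c
  completions-zero o c = sumᴸ-allFuns-zero N (weight-empty o c)

  completions-suc : ∀ m o c →
    completions (suc m) o c ≡ ∑[ i < N ] (𝟙 (toℕ i ≤? o) * completions m (suc o) (increment c i))
  completions-suc m o c = begin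
    completions (suc m) o c
      ≡⟨ sumᴸ-allFuns-suc m N (weight o c) ⟩
    sumᴸ (map (λ f → ∑[ i < N ] weight o c (i ∷ᶠ f)) (allFuns m N))
      ≡⟨ cong sumᴸ (map-cong (λ f → sum-cong-≗ (λ i → weight-cons o c i f)) (allFuns m N)) ⟩
    sumᴸ (map (λ f → ∑[ i < N ] (𝟙 (toℕ i ≤? o) * weight (suc o) (increment c i) f)) (allFuns m N))
      ≡⟨ sumᴸ-map-∑ (λ i f → 𝟙 (toℕ i ≤? o) * weight (suc o) (increment c i) f) (allFuns m N) ⟩
    ∑[ i < N ] sumᴸ (map (λ f → 𝟙 (toℕ i ≤? o) * weight (suc o) (increment c i) f) (allFuns m N))
      ≡⟨ sum-cong-≗ (λ i → sumᴸ-map-*ˡ (𝟙 (toℕ i ≤? o)) (weight (suc o) (increment c i)) (allFuns m N)) ⟩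
    ∑[ i < N ] (𝟙 (toℕ i ≤? o) * completions m (suc o) (increment c i)) ∎
    where open ≡-Reasoning

  completions-overfull : ∀ m o c y → 3 ≤ c y → completions m o c ≡ 0
  completions-overfull zero    o c y 3≤cy =
    trans (completions-zero o c)
          (cong (_* 𝟙 (singletonCount c ≟ j)) (𝟙-no (λ ≤2 → ≤⇒≯ (≤2 y) 3≤cy) (all? λ y → c y ≤? 2)))
  completions-overfull (suc m) o c y 3≤cy = trans (completions-suc m o c) (∑-zero λ i →
    trans (cong (𝟙 (toℕ i ≤? o) *_) (completions-overfull m (suc o) (increment c i) y (≤-trans 3≤cy (m≤n+m (c y) _))))
          (*-zeroʳ (𝟙 (toℕ i ≤? o))))

  CompletionsAreWalks : ℕ → Set
  CompletionsAreWalks m = ∀ o c → o + m ≡ N → Admissible o c →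
    completions m o c ≡ walk m (δ j) (zeroCountBelow o c) (singletonCount c)

  completions-walk-zero : CompletionsAreWalks 0
  completions-walk-zero o c _ adm = begin
    completions 0 o c             ≡⟨ completions-zero o c ⟩
    accepted c                    ≡⟨ cong (_* 𝟙 (singletonCount c ≟ j)) (𝟙-yes (atMostTwo adm) (all? λ y → c y ≤? 2)) ⟩
    1 * 𝟙 (singletonCount c ≟ j)  ≡⟨ *-identityˡ _ ⟩
    𝟙 (singletonCount c ≟ j)      ∎
    where open ≡-Reasoning

  module _ {m} (walks : CompletionsAreWalks m) {o} {c : Fin N → ℕ} (o+m+1≡N : o + suc m ≡ N) (adm : Admissible o c) where

    private
      Z S W₀ W₁ : ℕ
      Z  = zeroCountBelow o c
      S  = singletonCount c
      W₀ = walk m (δ j) Z (suc S)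
      W₁ = walk m (δ j) (suc Z) (S ∸ 1)

      o<N : o < N
      o<N = subst (o <_) o+m+1≡N (m<m+n o (s≤s z≤n))

      walks-increment : ∀ {i} → toℕ i ≤ o → c i ≤ 1 →
        completions m (suc o) (increment c i) ≡ walk m (δ j) (zeroCountBelow (suc o) (increment c i)) (singletonCount (increment c i))
      walks-increment {i} i≤o cᵢ≤1 =
        walks (suc o) (increment c i) (trans (sym (+-suc o m)) o+m+1≡N) (admissible-increment adm i≤o cᵢ≤1)

    completions-increment : ∀ i → toℕ i ≤ o →
      completions m (suc o) (increment c i) ≡ 𝟙 (c i ≟ 0) * W₀ + 𝟙 (c i ≟ 1) * W₁
    completions-increment i i≤o with c i in cᵢ≡
    ... | 0 = begin
      completions m (suc o) (increment c i) ≡⟨ walks-increment i≤o (≤-trans (≤-reflexive cᵢ≡) z≤n) ⟩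
      walk m (δ j) _ _                       ≡⟨ uncurry (cong₂ (walk m (δ j))) (increment-empty adm o<N i≤o cᵢ≡) ⟩
      W₀                                     ≡⟨ trans (+-identityʳ _) (+-identityʳ W₀) ⟨
      1 * W₀ + 0 * W₁                        ∎
      where open ≡-Reasoning
    ... | 1 = begin
      completions m (suc o) (increment c i) ≡⟨ walks-increment i≤o (≤-reflexive cᵢ≡) ⟩
      walk m (δ j) _ _                       ≡⟨ uncurry (cong₂ (walk m (δ j))) (increment-singleton adm o<N i≤o cᵢ≡) ⟩
      W₁                                     ≡⟨ +-identityʳ W₁ ⟨
      0 * W₀ + 1 * W₁                        ∎
      where open ≡-Reasoning
    ... | 2 = completions-overfull m (suc o) (increment c i) i (≤-reflexive (sym (cong₂ _+_ (𝟙-yes refl (i ≟ᶠ i)) cᵢ≡)))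
    ... | suc (suc (suc _)) = contradiction (subst (_≤ 2) cᵢ≡ (atMostTwo adm i)) λ { (s≤s (s≤s ())) }

    private
      summand : ∀ i (i≤?o : Dec (toℕ i ≤ o)) →
        𝟙 i≤?o * completions m (suc o) (increment c i) ≡ 𝟙 i≤?o * 𝟙 (c i ≟ 0) * W₀ + 𝟙 (c i ≟ 1) * W₁
      summand i (yes i≤o) = begin
        1 * completions m (suc o) (increment c i) ≡⟨ +-identityʳ _ ⟩
        completions m (suc o) (increment c i)     ≡⟨ completions-increment i i≤o ⟩
        𝟙 (c i ≟ 0) * W₀ + 𝟙 (c i ≟ 1) * W₁
          ≡⟨ cong (λ e → e * W₀ + 𝟙 (c i ≟ 1) * W₁) (+-identityʳ (𝟙 (c i ≟ 0))) ⟨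
        1 * 𝟙 (c i ≟ 0) * W₀ + 𝟙 (c i ≟ 1) * W₁   ∎
        where open ≡-Reasoning
      summand i (no  i≰o) = sym (cong (λ v → 𝟙 (v ≟ 1) * W₁) (vanishing adm i (<⇒≤ (≰⇒> i≰o))))

    completions-suc-walk : completions (suc m) o c ≡ walk (suc m) (δ j) Z S
    completions-suc-walk = begin
      completions (suc m) o c
        ≡⟨ completions-suc m o c ⟩
      ∑[ i < N ] (𝟙 (toℕ i ≤? o) * completions m (suc o) (increment c i))
        ≡⟨ sum-cong-≗ (λ i → summand i (toℕ i ≤? o)) ⟩
      ∑[ i < N ] (𝟙 (toℕ i ≤? o) * 𝟙 (c i ≟ 0) * W₀ + 𝟙 (c i ≟ 1) * W₁)
        ≡⟨ ∑-distrib-+ (λ i → 𝟙 (toℕ i ≤? o) * 𝟙 (c i ≟ 0) * W₀) (λ i → 𝟙 (c i ≟ 1) * W₁) ⟩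
      ∑[ i < N ] (𝟙 (toℕ i ≤? o) * 𝟙 (c i ≟ 0) * W₀) + ∑[ i < N ] (𝟙 (c i ≟ 1) * W₁)
        ≡⟨ cong₂ _+_ (*-distribʳ-sum W₀ (λ i → 𝟙 (toℕ i ≤? o) * 𝟙 (c i ≟ 0)))
                     (*-distribʳ-sum W₁ (λ i → 𝟙 (c i ≟ 1))) ⟨
      ∑[ i < N ] (𝟙 (toℕ i ≤? o) * 𝟙 (c i ≟ 0)) * W₀ + S * W₁
        ≡⟨ cong (λ e → e * W₀ + S * W₁) (sum-cong-≗ (λ i → cong (_* 𝟙 (c i ≟ 0)) (𝟙-<-suc (toℕ i) o))) ⟨
      zeroCountBelow (suc o) c * W₀ + S * W₁
        ≡⟨ cong (λ e → e * W₀ + S * W₁) (zeroCountBelow-suc adm o<N) ⟩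
      suc Z * W₀ + S * W₁ ∎
      where open ≡-Reasoning

  completions-walk : ∀ m → CompletionsAreWalks m
  completions-walk zero    = completions-walk-zero
  completions-walk (suc m) o c o+m+1≡N adm = completions-suc-walk (completions-walk m) o+m+1≡N adm

preimCount≡fibre : ∀ {n} (f : Fin n → Fin n) y → preimCount f y ≡ fibre f y
preimCount≡fibre f y = length-filter-allFin (λ i → f i ≟ᶠ y)

singletons≡singletonCount : ∀ {n} (f : Fin n → Fin n) → singletons f ≡ singletonCount (fibre f)
singletons≡singletonCount f =
  trans (length-filter-allFin (λ y → preimCount f y ≟ 1))
        (sum-cong-≗ (λ y → cong (λ v → 𝟙 (v ≟ 1)) (preimCount≡fibre f y)))

validCount≡walk : ∀ n j →
  length (filter (λ f → valid? f ×-dec (singletons f ≟ j)) (allFuns n n)) ≡ walk n (δ j) 0 0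
validCount≡walk n j = begin
  length (filter counted? (allFuns n n))
    ≡⟨ length-filter≡sum counted? (allFuns n n) ⟩
  sumᴸ (map (𝟙 ∘ counted?) (allFuns n n))
    ≡⟨ cong sumᴸ (map-cong counted≡weight (allFuns n n)) ⟩
  completions n 0 empty
    ≡⟨ completions-walk n 0 empty refl (record { vanishing = λ _ _ → refl ; atMostTwo = λ _ → z≤n }) ⟩
  walk n (δ j) (zeroCountBelow 0 empty) (singletonCount empty)
    ≡⟨ cong₂ (walk n (δ j)) (sum-replicate-zero n) (sum-replicate-zero n) ⟩
  walk n (δ j) 0 0 ∎
  where
    open ≡-Reasoning
    open Completions n j
    empty : Fin n → ℕ
    empty _ = 0
    counted? : ∀ f → Dec (Valid f × singletons f ≡ j)
    counted? f = valid? f ×-dec (singletons f ≟ j)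
    counted≡weight : ∀ f → 𝟙 (counted? f) ≡ weight 0 empty f
    counted≡weight f = begin
      𝟙 (counted? f)
        ≡⟨ 𝟙-×-dec (valid? f) (singletons f ≟ j) ⟩
      𝟙 (valid? f) * 𝟙 (singletons f ≟ j)
        ≡⟨ cong (_* 𝟙 (singletons f ≟ j)) (𝟙-×-dec triangular? bounded?) ⟩
      𝟙 triangular? * 𝟙 bounded? * 𝟙 (singletons f ≟ j)
        ≡⟨ *-assoc (𝟙 triangular?) (𝟙 bounded?) (𝟙 (singletons f ≟ j)) ⟩
      𝟙 triangular? * (𝟙 bounded? * 𝟙 (singletons f ≟ j))
        ≡⟨ cong (𝟙 triangular? *_) (cong₂ _*_ (𝟙-all?-≤-cong (preimCount≡fibre f) (λ _ → refl))
                                                (cong (λ s → 𝟙 (s ≟ j)) (singletons≡singletonCount f))) ⟩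
      weight 0 empty f ∎
      where
        triangular? : Dec (∀ k → toℕ (f k) ≤ toℕ k)
        triangular? = all? λ k → toℕ (f k) ≤? toℕ k
        bounded? : Dec (∀ y → preimCount f y ≤ 2)
        bounded? = all? λ y → preimCount f y ≤? 2

ℕtoℚ≡mkℚ : ∀ m → ℕtoℚ m ≡ mkℚ (ℤ.+ m) 0 (Coprime.sym (Coprime.1-coprimeTo m))
ℕtoℚ≡mkℚ m = ℚ.normalize-coprime (Coprime.sym (Coprime.1-coprimeTo m))

ℕtoℚ-+ : ∀ m n → ℕtoℚ (m + n) ≡ ℕtoℚ m ℚ.+ ℕtoℚ n
ℕtoℚ-+ m n = sym (begin
  ℕtoℚ m ℚ.+ ℕtoℚ n
    ≡⟨ cong₂ ℚ._+_ (ℕtoℚ≡mkℚ m) (ℕtoℚ≡mkℚ n) ⟩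
  ((ℤ.+ m) ℤ.* (ℤ.+ 1) ℤ.+ (ℤ.+ n) ℤ.* (ℤ.+ 1)) ℚ./ 1
    ≡⟨ ℚ./-cong (trans (cong₂ ℤ._+_ (ℤ.*-identityʳ (ℤ.+ m)) (ℤ.*-identityʳ (ℤ.+ n))) (sym (ℤ.pos-+ m n))) refl ⟩
  ℕtoℚ (m + n) ∎)
  where open ≡-Reasoning

ℕtoℚ-* : ∀ m n → ℕtoℚ (m * n) ≡ ℕtoℚ m ℚ.* ℕtoℚ n
ℕtoℚ-* m n = sym (begin
  ℕtoℚ m ℚ.* ℕtoℚ n                ≡⟨ cong₂ ℚ._*_ (ℕtoℚ≡mkℚ m) (ℕtoℚ≡mkℚ n) ⟩
  ((ℤ.+ m) ℤ.* (ℤ.+ n)) ℚ./ 1      ≡⟨ ℚ./-cong (sym (ℤ.pos-* m n)) refl ⟩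
  ℕtoℚ (m * n)                     ∎)
  where open ≡-Reasoning

ℕtoℚ-recurrence : ∀ n k x y z → 2 * x + k * y ≡ (n + 2) * y + 2 * (2 + k) * z →
  ℕtoℚ x ≡ (ℕtoℚ (2 + k) ℚ.* ℕtoℚ z ℚ.- ½ ℚ.* (ℕtoℚ k ℚ.* ℕtoℚ y))
           ℚ.+ (ℕtoℚ (n + 2) ℚ.* ½) ℚ.* ℕtoℚ y
ℕtoℚ-recurrence n k x y z eq = begin
  x′
    ≡⟨ solve 3 (λ x′ y′ k′ → x′ := con ½ :* (con (ℕtoℚ 2) :* x′ :+ k′ :* y′) :- con ½ :* (k′ :* y′))
               refl x′ y′ k′ ⟩
  ½ ℚ.* (ℕtoℚ 2 ℚ.* x′ ℚ.+ k′ ℚ.* y′) ℚ.- ½ ℚ.* (k′ ℚ.* y′)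
    ≡⟨ cong (λ w → ½ ℚ.* w ℚ.- ½ ℚ.* (k′ ℚ.* y′)) eq-in-ℚ ⟩
  ½ ℚ.* (n′ ℚ.* y′ ℚ.+ ℕtoℚ 2 ℚ.* k₂′ ℚ.* z′) ℚ.- ½ ℚ.* (k′ ℚ.* y′)
    ≡⟨ solve 5 (λ y′ z′ k′ k₂′ n′ → con ½ :* (n′ :* y′ :+ con (ℕtoℚ 2) :* k₂′ :* z′) :- con ½ :* (k′ :* y′)
                                   := (k₂′ :* z′ :- con ½ :* (k′ :* y′)) :+ (n′ :* con ½) :* y′)
               refl y′ z′ k′ k₂′ n′ ⟩
  (k₂′ ℚ.* z′ ℚ.- ½ ℚ.* (k′ ℚ.* y′)) ℚ.+ (n′ ℚ.* ½) ℚ.* y′ ∎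
  where
    open ≡-Reasoning
    open +-*-Solver
    x′ y′ z′ k′ k₂′ n′ : ℚ
    x′ = ℕtoℚ x
    y′ = ℕtoℚ y
    z′ = ℕtoℚ z
    k′ = ℕtoℚ k
    k₂′ = ℕtoℚ (2 + k)
    n′ = ℕtoℚ (n + 2)
    eq-in-ℚ : ℕtoℚ 2 ℚ.* x′ ℚ.+ k′ ℚ.* y′ ≡ n′ ℚ.* y′ ℚ.+ ℕtoℚ 2 ℚ.* k₂′ ℚ.* z′
    eq-in-ℚ = begin
      ℕtoℚ 2 ℚ.* x′ ℚ.+ k′ ℚ.* y′               ≡⟨ cong₂ ℚ._+_ (ℕtoℚ-* 2 x) (ℕtoℚ-* k y) ⟨
      ℕtoℚ (2 * x) ℚ.+ ℕtoℚ (k * y)             ≡⟨ ℕtoℚ-+ (2 * x) (k * y) ⟨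
      ℕtoℚ (2 * x + k * y)                      ≡⟨ cong ℕtoℚ eq ⟩
      ℕtoℚ ((n + 2) * y + 2 * (2 + k) * z)      ≡⟨ ℕtoℚ-+ ((n + 2) * y) (2 * (2 + k) * z) ⟩
      ℕtoℚ ((n + 2) * y) ℚ.+ ℕtoℚ (2 * (2 + k) * z)
        ≡⟨ cong₂ ℚ._+_ (ℕtoℚ-* (n + 2) y) (trans (ℕtoℚ-* (2 * (2 + k)) z) (cong (ℚ._* z′) (ℕtoℚ-* 2 (2 + k)))) ⟩
      n′ ℚ.* y′ ℚ.+ ℕtoℚ 2 ℚ.* k₂′ ℚ.* z′       ∎

A≡walk : ∀ n j → A n j ≡ ℕtoℚ (walk n (δ j) 0 0)
A≡walk n j = cong ℕtoℚ (validCount≡walk n j)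

mulT-deriv : ∀ p k → mulT (deriv p) k ≡ ℕtoℚ k ℚ.* p k
mulT-deriv p zero    = sym (ℚ.*-zeroˡ (p 0))
mulT-deriv p (suc k) = refl

A-recurrence : ∀ n j → A (suc n) j
  ≡ ((deriv (A n) ⊖ (½ ⊛ mulT (mulT (deriv (A n))))) ⊕ ((ℕtoℚ (n + 2) ℚ.* ½) ⊛ mulT (A n))) j
A-recurrence n zero = begin
  A (suc n) 0
    ≡⟨ trans (A≡walk (suc n) 0) (trans (cong ℕtoℚ (walk-δ-zero n)) (sym (A≡walk n 1))) ⟩
  A n 1
    ≡⟨ solve 2 (λ y c → y := (con (ℕtoℚ 1) :* y :- con ½ :* con ℚ.0ℚ) :+ c :* con ℚ.0ℚ) refl (A n 1) c ⟩
  (ℕtoℚ 1 ℚ.* A n 1 ℚ.- ½ ℚ.* ℚ.0ℚ) ℚ.+ c ℚ.* ℚ.0ℚ ∎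
  where
    open ≡-Reasoning
    open +-*-Solver
    c : ℚ
    c = ℕtoℚ (n + 2) ℚ.* ½
A-recurrence n (suc k) = begin
  A (suc n) (suc k)
    ≡⟨ A≡walk (suc n) (suc k) ⟩
  ℕtoℚ (walk (suc n) (δ (suc k)) 0 0)
    ≡⟨ ℕtoℚ-recurrence n k (walk (suc n) (δ (suc k)) 0 0) (W k) (W (2 + k)) (walk-δ-suc n k) ⟩
  (ℕtoℚ (2 + k) ℚ.* ℕtoℚ (W (2 + k)) ℚ.- ½ ℚ.* (ℕtoℚ k ℚ.* ℕtoℚ (W k))) ℚ.+ c ℚ.* ℕtoℚ (W k)
    ≡⟨ cong₂ (λ u v → (ℕtoℚ (2 + k) ℚ.* u ℚ.- ½ ℚ.* (ℕtoℚ k ℚ.* v)) ℚ.+ c ℚ.* v)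
             (A≡walk n (2 + k)) (A≡walk n k) ⟨
  (ℕtoℚ (2 + k) ℚ.* A n (2 + k) ℚ.- ½ ℚ.* (ℕtoℚ k ℚ.* A n k)) ℚ.+ c ℚ.* A n k
    ≡⟨ cong (λ w → (ℕtoℚ (2 + k) ℚ.* A n (2 + k) ℚ.- ½ ℚ.* w) ℚ.+ c ℚ.* A n k) (mulT-deriv (A n) k) ⟨
  (ℕtoℚ (2 + k) ℚ.* A n (2 + k) ℚ.- ½ ℚ.* mulT (deriv (A n)) k) ℚ.+ c ℚ.* A n k ∎
  where
    open ≡-Reasoning
    c : ℚ
    c = ℕtoℚ (n + 2) ℚ.* ½
    W : ℕ → ℕ
    W j = walk n (δ j) 0 0

A₀≡1 : ∀ j → A 0 j ≡ const 1ℚ j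
A₀≡1 0       = refl
A₀≡1 (suc j) = refl

A₁≡t : ∀ j → A 1 j ≡ tPow 1 j
A₁≡t 0             = refl
A₁≡t 1             = refl
A₁≡t (suc (suc j)) = refl

A₂≡1+t² : ∀ j → A 2 j ≡ (tPow 0 ⊕ tPow 2) j
A₂≡1+t² 0                   = refl
A₂≡1+t² 1                   = refl
A₂≡1+t² 2                   = refl
A₂≡1+t² (suc (suc (suc j))) = refl

A₃≡4t+t³ : ∀ j → A 3 j ≡ ((ℕtoℚ 4 ⊛ tPow 1) ⊕ tPow 3) j
A₃≡4t+t³ 0                         = refl
A₃≡4t+t³ 1                         = refl
A₃≡4t+t³ 2                         = refl
A₃≡4t+t³ 3                         = refl
A₃≡4t+t³ (suc (suc (suc (suc j)))) = refl

lemma11p9 :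
    (∀ j → A 0 j ≡ const 1ℚ j)
    × (∀ j → A 1 j ≡ tPow 1 j)
    × (∀ j → A 2 j ≡ (tPow 0 ⊕ tPow 2) j)
    × (∀ j → A 3 j ≡ ((ℕtoℚ 4 ⊛ tPow 1) ⊕ tPow 3) j)
    × (∀ n j → A (suc n) j
         ≡ ((deriv (A n) ⊖ (½ ⊛ mulT (mulT (deriv (A n)))))
            ⊕ ((ℕtoℚ (n + 2) ℚ.* ½) ⊛ mulT (A n))) j)
lemma11p9 = A₀≡1 , A₁≡t , A₂≡1+t² , A₃≡4t+t³ , A-recurrence
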